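{- Let $q=p^h$ with $p$ prime and $h>1$. Let $M$ be a multiset of size $nq$ in $\mathrm{AG}(2,q)$ having $k\leq\frac pn$ special directions. Then every line whose slope is a special direction of $M$ and which passes through a point not in $M$ contains fewer than $p$ points of $M$.
   Context: Lines of $\mathrm{AG}(2,q)$ with slope $d\in\mathbb F_q$ are $Y=dX+b$, with slope $\infty$ are $X+b=0$. Sizes and intersections of multisets count multiplicities; a point is not in $M$ if its multiplicity is $0$. A direction $(d)$ is special for $M$ if not every line of slope $d$ contains $\lfloor|M|/q\rfloor$ or $\lceil|M|/q\rceil$ points of $M$. -}

module Defs where

open import Level using (0ℓ)
open import Algebra.Bundles using (CommutativeRing)
open import Data.Nat as ℕ using (ℕ; zero; suc)
open import Data.Fin as Fin using (Fin)
open import Data.Fin.Properties as FinP using ()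
open import Data.List using (List; map; allFin; _∷_)
open import Data.Nat.ListAction using (sum)
open import Data.Sum using (_⊎_)
open import Relation.Nullary.Decidable using (_⊎-dec_)
open import Data.Bool using (if_then_else_)
open import Data.Maybe using (Maybe; just; nothing)
open import Data.Product using (Σ; ∃; _×_; _,_)
open import Function.Bundles using (_↔_; Inverse)
open import Relation.Binary.PropositionalEquality using (_≡_; _≢_; cong; sym; trans; subst)
open import Relation.Binary.Definitions using (DecidableEquality)
open import Relation.Nullary using (¬_; Dec; yes; no; does)
open import Relation.Nullary.Decidable using (map′; ¬?)

record FiniteField (q : ℕ) : Set₁ where
  field
    commutativeRing : CommutativeRing 0ℓ 0ℓ
  open CommutativeRing commutativeRing public
  field
    ≈⇒≡     : ∀ {x y} → x ≈ y → x ≡ y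
    0≢1     : ¬ (0# ≈ 1#)
    inverse : ∀ x → ¬ (x ≈ 0#) → ∃ λ y → (x * y) ≈ 1#
    enum    : Carrier ↔ Fin q

-- ⌊ m / n ⌋ and ⌈ m / n ⌉ (only used with n = q ≥ 1; the n = 0 clause is unreachable)
floorDiv : ℕ → ℕ → ℕ
floorDiv m zero    = 0
floorDiv m (suc r) = m ℕ./ suc r

ceilDiv : ℕ → ℕ → ℕ
ceilDiv m zero    = 0
ceilDiv m (suc r) = (m ℕ.+ r) ℕ./ suc r

module AG {q : ℕ} (F : FiniteField q) where
  open FiniteField F using (Carrier; _+_; _*_; 0#; enum)

  elt : Fin q → Carrier
  elt = Inverse.from enum

  _≟F_ : DecidableEquality Carrier
  x ≟F y = map′ inj (cong (Inverse.to enum)) (Inverse.to enum x FinP.≟ Inverse.to enum y)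
    where
    inj : Inverse.to enum x ≡ Inverse.to enum y → x ≡ y
    inj e = trans (sym (Inverse.strictlyInverseʳ enum x))
              (trans (cong (Inverse.from enum) e) (Inverse.strictlyInverseʳ enum y))

  ∑ : (Carrier → ℕ) → ℕ
  ∑ f = sum (map (λ i → f (elt i)) (allFin q))

  Point : Set
  Point = Carrier × Carrier

  Multiset : Set
  Multiset = Carrier → Carrier → ℕ

  size : Multiset → ℕ
  size M = ∑ λ x → ∑ λ y → M x y

  -- slopes: just d for d ∈ F, nothing for ∞
  Slope : Set
  Slope = Maybe Carrier

  OnLine : Slope → Carrier → Point → Set
  OnLine (just d) b (x , y) = y ≡ (d * x) + b
  OnLine nothing  b (x , y) = x + b ≡ 0#

  onLine? : ∀ s b P → Dec (OnLine s b P)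
  onLine? (just d) b (x , y) = y ≟F ((d * x) + b)
  onLine? nothing  b (x , y) = (x + b) ≟F 0#

  lineCount : Multiset → Slope → Carrier → ℕ
  lineCount M s b = ∑ λ x → ∑ λ y → restrict (onLine? s b (x , y)) (M x y)
    where
    restrict : ∀ {A : Set} → Dec A → ℕ → ℕ
    restrict (yes _) m = m
    restrict (no _)  _ = 0

  Balanced : Multiset → Slope → Carrier → Set
  Balanced M s b = (lineCount M s b ≡ floorDiv (size M) q) ⊎ (lineCount M s b ≡ ceilDiv (size M) q)

  balanced? : ∀ M s b → Dec (Balanced M s b)
  balanced? M s b = (lineCount M s b ℕ.≟ floorDiv (size M) q) ⊎-dec (lineCount M s b ℕ.≟ ceilDiv (size M) q)

  Special : Multiset → Slope → Set
  Special M s = ¬ (∀ b → Balanced M s b)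

  special? : ∀ M s → Dec (Special M s)
  special? M s = ¬? (map′ (λ h b → subst (Balanced M s) (Inverse.strictlyInverseʳ enum b) (h (Inverse.to enum b)))
                          (λ h i → h (elt i))
                          (FinP.all? (λ i → balanced? M s (elt i))))

  slopes : List Slope
  slopes = nothing ∷ map (λ i → just (elt i)) (allFin q)

  numSpecial : Multiset → ℕ
  numSpecial M = sum (map (λ s → if does (special? M s) then 1 else 0) slopes)

{-# OPTIONS --safe #-}
-- Let P be a point of multiplicity 0 on the line ℓ. The q + 1 lines through P
-- pairwise meet only in P, so their point counts add up to at most |M| = nq.
-- A line in a non-special direction contains exactly n points.
module Submission where

open import Defs
open import Data.Bool.Base using (if_then_else_)
open import Data.Empty using (⊥-elim)
open import Data.Fin.Base using (Fin)
open import Data.Fin.Properties using (nonZeroIndex)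
open import Data.List.Base using ([]; _∷_; map; length; allFin)
open import Data.List.Properties using (map-cong; length-map; length-tabulate)
open import Data.List.Membership.Propositional using (_∈_)
open import Data.List.Membership.Propositional.Properties using (∈-map⁺; ∈-allFin)
open import Data.List.Relation.Unary.All as All using (All; []; _∷_)
open import Data.List.Relation.Unary.All.Properties as All using ()
open import Data.List.Relation.Unary.Any using (here; there)
open import Data.List.Relation.Unary.Unique.Propositional using (Unique; []; _∷_)
open import Data.List.Relation.Unary.Unique.Propositional.Properties as Unique using (allFin⁺)
open import Data.Maybe.Base using (just; nothing)
open import Data.Maybe.Properties using (just-injective)
open import Data.Nat.Base using (ℕ; suc; _^_; _≤_; _<_; z≤n; NonZero; _/_)
open import Data.Nat.Primality using (Prime)
open import Data.Product.Base using (∃; _×_; _,_; proj₁; proj₂; uncurry)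
open import Data.Sum.Base using (_⊎_; inj₁; inj₂; [_,_]′)
open import Function.Base using (id)
open import Function.Bundles using (Inverse; Injection)
open import Function.Properties.Inverse using (↔-sym; ↔⇒↣)
open import Relation.Binary.PropositionalEquality as ≡ using (_≡_; _≢_)
open import Relation.Nullary using (¬_; Dec; yes; no; does; contradiction)

module LinesThrough {q : ℕ} (F : FiniteField q) where
  open FiniteField F
  open AG F using (Point; Slope; OnLine; _≟F_)
  open import Algebra.Properties.Ring ring
    using (x≈z//y; +-inverseʳ-unique; x∙y⁻¹≈ε⇒x≈y; //-rightDividesʳ; x[y-z]≈xy-xz)
  open import Relation.Binary.Reasoning.Setoid setoid

  *-cancelʳ-nonzero : ∀ {u d e} → ¬ (u ≈ 0#) → d * u ≈ e * u → d ≈ e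
  *-cancelʳ-nonzero {u} {d} {e} u≉0 du≈eu with inverse u u≉0
  ... | w , uw≈1 = begin
    d             ≈⟨ *-identityʳ d ⟨
    d * 1#        ≈⟨ *-congˡ uw≈1 ⟨
    d * (u * w)   ≈⟨ *-assoc d u w ⟨
    d * u * w     ≈⟨ *-congʳ du≈eu ⟩
    e * u * w     ≈⟨ *-assoc e u w ⟩
    e * (u * w)   ≈⟨ *-congˡ uw≈1 ⟩
    e * 1#        ≈⟨ *-identityʳ e ⟩
    e             ∎

  through : Slope → Point → Carrier
  through (just d) (x , y) = y - d * x
  through nothing  (x , y) = - x

  through-unique : ∀ σ {b P} → OnLine σ b P → b ≡ through σ P
  through-unique (just d) {b} {x , y} y≡dx+b =
    ≈⇒≡ (x≈z//y b (d * x) y (trans (+-comm b (d * x)) (reflexive (≡.sym y≡dx+b))))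
  through-unique nothing {b} {x , y} x+b≡0 = ≈⇒≡ (+-inverseʳ-unique x b (reflexive x+b≡0))

  point-slope-form : ∀ {d x y x₀ y₀} → OnLine (just d) (through (just d) (x₀ , y₀)) (x , y) →
                     y - y₀ ≈ d * (x - x₀)
  point-slope-form {d} {x} {y} {x₀} {y₀} on = begin
    y - y₀                            ≈⟨ +-congʳ (reflexive on) ⟩
    d * x + (y₀ - d * x₀) - y₀        ≈⟨ +-congʳ (+-congˡ (+-comm y₀ (- (d * x₀)))) ⟩
    d * x + (- (d * x₀) + y₀) - y₀    ≈⟨ +-congʳ (+-assoc (d * x) (- (d * x₀)) y₀) ⟨
    d * x - d * x₀ + y₀ - y₀          ≈⟨ //-rightDividesʳ y₀ (d * x - d * x₀) ⟩
    d * x - d * x₀                    ≈⟨ x[y-z]≈xy-xz d x x₀ ⟨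
    d * (x - x₀)                      ∎

  vertical-through⇒x≡x₀ : ∀ {x y x₀ y₀} → OnLine nothing (through nothing (x₀ , y₀)) (x , y) → x ≡ x₀
  vertical-through⇒x≡x₀ {x} {x₀ = x₀} on = ≈⇒≡ (x∙y⁻¹≈ε⇒x≈y x x₀ (reflexive on))

  sloped-through⇒x≡x₀⇒≡ : ∀ {d x y x₀ y₀} → OnLine (just d) (through (just d) (x₀ , y₀)) (x , y) →
                          x ≡ x₀ → (x , y) ≡ (x₀ , y₀)
  sloped-through⇒x≡x₀⇒≡ {d} {x} {y} {x₀} {y₀} on ≡.refl = ≡.cong (x ,_) (≈⇒≡ (x∙y⁻¹≈ε⇒x≈y y y₀ (begin
    y - y₀         ≈⟨ point-slope-form on ⟩
    d * (x - x₀)   ≈⟨ *-congˡ (-‿inverseʳ x) ⟩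
    d * 0#         ≈⟨ zeroʳ d ⟩
    0#             ∎)))

  lines-through-meet-only-at : ∀ {σ τ P Q} → σ ≢ τ →
    OnLine σ (through σ P) Q → OnLine τ (through τ P) Q → Q ≡ P
  lines-through-meet-only-at {nothing} {nothing} σ≢τ _ _ = ⊥-elim (σ≢τ ≡.refl)
  lines-through-meet-only-at {nothing} {just e} {_ , y₀} {_ , y} _ onσ onτ =
    sloped-through⇒x≡x₀⇒≡ onτ (vertical-through⇒x≡x₀ {y = y} {y₀ = y₀} onσ)
  lines-through-meet-only-at {just d} {nothing} {_ , y₀} {_ , y} _ onσ onτ =
    sloped-through⇒x≡x₀⇒≡ onσ (vertical-through⇒x≡x₀ {y = y} {y₀ = y₀} onτ)
  lines-through-meet-only-at {just d} {just e} {x₀ , y₀} {x , y} d≢e onσ onτ with x ≟F x₀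
  ... | yes x≡x₀ = sloped-through⇒x≡x₀⇒≡ onσ x≡x₀
  ... | no x≢x₀ = ⊥-elim (d≢e (≡.cong just (≈⇒≡ (*-cancelʳ-nonzero x-x₀≉0 (begin
    d * (x - x₀)   ≈⟨ point-slope-form onσ ⟨
    y - y₀         ≈⟨ point-slope-form onτ ⟩
    e * (x - x₀)   ∎)))))
    where
    x-x₀≉0 : ¬ (x - x₀ ≈ 0#)
    x-x₀≉0 x-x₀≈0 = x≢x₀ (≈⇒≡ (x∙y⁻¹≈ε⇒x≈y x x₀ x-x₀≈0))

-- Imported only here: these operators would clash with the field operations above.
open import Data.Nat.Base using (_+_; _*_)
open import Data.Nat.DivMod using (m*n/n≡m; +-distrib-/-∣ˡ; m<n⇒m/n≡0)
open import Data.Nat.Divisibility using (n∣m*n)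
open import Data.Nat.ListAction using (sum)
open import Data.Nat.Properties
  using (+-identityʳ; +-assoc; +-comm; *-comm; *-identityˡ; *-distribʳ-+; +-mono-≤; +-monoˡ-≤;
         +-cancelʳ-≤; ≤-refl; ≤-trans; ≤-reflexive; m≤n+m; m<n+m; n<1+n; _≟_;
         +-commutativeSemigroup; module ≤-Reasoning)
open import Algebra.Properties.CommutativeSemigroup +-commutativeSemigroup using (interchange; xy∙z≈xz∙y)

module _ {a} {A : Set a} where

  sum-map-zero : ∀ {f : A → ℕ} {xs} → All (λ x → f x ≡ 0) xs → sum (map f xs) ≡ 0
  sum-map-zero []             = ≡.refl
  sum-map-zero (fx≡0 ∷ fxs≡0) = ≡.cong₂ _+_ fx≡0 (sum-map-zero fxs≡0)

  sum-map-+ : ∀ (f g : A → ℕ) xs → sum (map (λ x → f x + g x) xs) ≡ sum (map f xs) + sum (map g xs)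
  sum-map-+ f g []       = ≡.refl
  sum-map-+ f g (x ∷ xs) = ≡.trans (≡.cong (f x + g x +_) (sum-map-+ f g xs))
                                   (interchange (f x) (g x) (sum (map f xs)) (sum (map g xs)))

  sum-map-*ʳ : ∀ (f : A → ℕ) n xs → sum (map (λ x → f x * n) xs) ≡ sum (map f xs) * n
  sum-map-*ʳ f n []       = ≡.refl
  sum-map-*ʳ f n (x ∷ xs) = ≡.trans (≡.cong (f x * n +_) (sum-map-*ʳ f n xs))
                                    (≡.sym (*-distribʳ-+ n (f x) (sum (map f xs))))

  sum-map-mono-≤ : ∀ {f g : A → ℕ} → (∀ x → f x ≤ g x) → ∀ xs → sum (map f xs) ≤ sum (map g xs)
  sum-map-mono-≤ f≤g []       = z≤n
  sum-map-mono-≤ f≤g (x ∷ xs) = +-mono-≤ (f≤g x) (sum-map-mono-≤ f≤g xs)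

  length*n≤sum-map : ∀ {f : A → ℕ} {n} → (∀ x → n ≤ f x) → ∀ xs → length xs * n ≤ sum (map f xs)
  length*n≤sum-map n≤f []       = z≤n
  length*n≤sum-map n≤f (x ∷ xs) = +-mono-≤ (n≤f x) (length*n≤sum-map n≤f xs)

  length*n+c≤sum-map : ∀ {f : A → ℕ} {n c s xs} → (∀ x → n ≤ f x) → s ∈ xs → n + c ≤ f s →
                       length xs * n + c ≤ sum (map f xs)
  length*n+c≤sum-map {f} {n} {c} {xs = x ∷ xs} n≤f (here ≡.refl) n+c≤fx = begin
    n + length xs * n + c     ≡⟨ xy∙z≈xz∙y n (length xs * n) c ⟩
    n + c + length xs * n     ≤⟨ +-mono-≤ n+c≤fx (length*n≤sum-map n≤f xs) ⟩
    f x + sum (map f xs)      ∎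
    where open ≤-Reasoning
  length*n+c≤sum-map {f} {n} {c} {xs = x ∷ xs} n≤f (there s∈xs) n+c≤fs = begin
    n + length xs * n + c     ≡⟨ +-assoc n (length xs * n) c ⟩
    n + (length xs * n + c)   ≤⟨ +-mono-≤ (n≤f x) (length*n+c≤sum-map n≤f s∈xs n+c≤fs) ⟩
    f x + sum (map f xs)      ∎
    where open ≤-Reasoning

  sum-map-≤-atMostOneNonzero : ∀ {f : A → ℕ} {m} → (∀ x → f x ≤ m) →
    (∀ {x y} → x ≢ y → f x ≡ 0 ⊎ f y ≡ 0) → ∀ {xs} → Unique xs → sum (map f xs) ≤ m
  sum-map-≤-atMostOneNonzero f≤m disjoint [] = z≤n
  sum-map-≤-atMostOneNonzero {f} {m} f≤m disjoint {x ∷ xs} (x≢xs ∷ unique) with f x ≟ 0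
  ... | yes fx≡0 = ≡.subst (λ k → k + sum (map f xs) ≤ m) (≡.sym fx≡0)
                           (sum-map-≤-atMostOneNonzero f≤m disjoint unique)
  ... | no fx≢0 = begin
    f x + sum (map f xs)   ≡⟨ ≡.cong (f x +_) (sum-map-zero (All.map vanish x≢xs)) ⟩
    f x + 0                ≡⟨ +-identityʳ (f x) ⟩
    f x                    ≤⟨ f≤m x ⟩
    m                      ∎
    where
    open ≤-Reasoning
    vanish : ∀ {y} → x ≢ y → f y ≡ 0
    vanish x≢y = [ (λ fx≡0 → contradiction fx≡0 fx≢0) , id ]′ (disjoint x≢y)

module _ {a b} {A : Set a} {B : Set b} where

  sum-map-comm : ∀ (f : A → B → ℕ) xs ys →
    sum (map (λ x → sum (map (f x) ys)) xs) ≡ sum (map (λ y → sum (map (λ x → f x y) xs)) ys)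
  sum-map-comm f []       ys = ≡.sym (sum-map-zero (All.universal (λ _ → ≡.refl) ys))
  sum-map-comm f (x ∷ xs) ys = ≡.trans (≡.cong (sum (map (f x) ys) +_) (sum-map-comm f xs ys))
                                       (≡.sym (sum-map-+ (f x) (λ y → sum (map (λ x → f x y) xs)) ys))

floorDiv-multiple : ∀ n q .{{_ : NonZero q}} → floorDiv (n * q) q ≡ n
floorDiv-multiple n (suc r) = m*n/n≡m n (suc r)

ceilDiv-multiple : ∀ n q .{{_ : NonZero q}} → ceilDiv (n * q) q ≡ n
ceilDiv-multiple n (suc r) = begin
  (n * suc r + r) / suc r           ≡⟨ +-distrib-/-∣ˡ r (n∣m*n n) ⟩
  n * suc r / suc r + r / suc r     ≡⟨ ≡.cong₂ _+_ (m*n/n≡m n (suc r)) (m<n⇒m/n≡0 (n<1+n r)) ⟩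
  n + 0                             ≡⟨ +-identityʳ n ⟩
  n                                 ∎
  where open ≡.≡-Reasoning

restrict : ∀ {p} {P : Set p} → Dec P → ℕ → ℕ
restrict (yes _) m = m
restrict (no _)  _ = 0

restrict-≤ : ∀ {p} {P : Set p} (P? : Dec P) m → restrict P? m ≤ m
restrict-≤ (yes _) m = ≤-refl
restrict-≤ (no _)  m = z≤n

indicator : ∀ {p} {P : Set p} → Dec P → ℕ
indicator P? = if does P? then 1 else 0

indicator-yes : ∀ {p} {P : Set p} (P? : Dec P) → P → indicator P? ≡ 1
indicator-yes (yes _) _ = ≡.refl
indicator-yes (no ¬p) p = contradiction p ¬p

module _ {q : ℕ} (F : FiniteField q) where
  open AG F
  open LinesThrough F
  open FiniteField F using (Carrier; 0#; enum)

  instance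
    q-nonZero : NonZero q
    q-nonZero = nonZeroIndex (Inverse.to enum 0#)

  ∑-cong : ∀ {f g : Carrier → ℕ} → (∀ x → f x ≡ g x) → ∑ f ≡ ∑ g
  ∑-cong f≗g = ≡.cong sum (map-cong (λ i → f≗g (elt i)) (allFin q))

  ∑-mono-≤ : ∀ {f g : Carrier → ℕ} → (∀ x → f x ≤ g x) → ∑ f ≤ ∑ g
  ∑-mono-≤ f≤g = sum-map-mono-≤ (λ i → f≤g (elt i)) (allFin q)

  slopes-unique : Unique slopes
  slopes-unique = All.map⁺ (All.universal (λ _ ()) (allFin q))
                ∷ Unique.map⁺ (λ e → Injection.injective (↔⇒↣ (↔-sym enum)) (just-injective e)) (allFin⁺ q)

  ∈-slopes : ∀ σ → σ ∈ slopes
  ∈-slopes nothing  = here ≡.refl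
  ∈-slopes (just d) = there (≡.subst (λ e → just e ∈ map (λ i → just (elt i)) (allFin q))
                                     (Inverse.strictlyInverseʳ enum d)
                                     (∈-map⁺ (λ i → just (elt i)) (∈-allFin (Inverse.to enum d))))

  length-slopes : length slopes ≡ suc q
  length-slopes = ≡.cong suc (≡.trans (length-map _ (allFin q)) (length-tabulate id))

  -- The summand of lineCount is local to its where block in Defs and cannot be
  -- named, so it is obtained by unification and then identified with restrict.
  lineCount-summand : ∀ M s b → ∃ λ (T : Fin q → Fin q → ℕ) →
    lineCount M s b ≡ sum (map (λ i → sum (map (T i) (allFin q))) (allFin q))
  lineCount-summand M s b = _ , ≡.refl

  lineCount-summand≡restrict : ∀ M s b i j →
    proj₁ (lineCount-summand M s b) i j ≡ restrict (onLine? s b (elt i , elt j)) (M (elt i) (elt j))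
  lineCount-summand≡restrict M s b i j with onLine? s b (elt i , elt j)
  ... | yes _ = ≡.refl
  ... | no _  = ≡.refl

  lineCount≡∑∑restrict : ∀ M s b → lineCount M s b ≡ ∑ λ x → ∑ λ y → restrict (onLine? s b (x , y)) (M x y)
  lineCount≡∑∑restrict M s b = ≡.trans (proj₂ (lineCount-summand M s b))
    (≡.cong sum (map-cong (λ i → ≡.cong sum (map-cong (lineCount-summand≡restrict M s b i) (allFin q))) (allFin q)))

  multiplicity-on-lines-through-≤ : ∀ (M : Multiset) {x₀ y₀} → M x₀ y₀ ≡ 0 → ∀ x y →
    sum (map (λ σ → restrict (onLine? σ (through σ (x₀ , y₀)) (x , y)) (M x y)) slopes) ≤ M x y
  multiplicity-on-lines-through-≤ M {x₀} {y₀} empty x y =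
    sum-map-≤-atMostOneNonzero (λ σ → restrict-≤ _ (M x y)) disjoint slopes-unique
    where
    disjoint : ∀ {σ τ} → σ ≢ τ → restrict (onLine? σ (through σ (x₀ , y₀)) (x , y)) (M x y) ≡ 0
                                ⊎ restrict (onLine? τ (through τ (x₀ , y₀)) (x , y)) (M x y) ≡ 0
    disjoint {σ} {τ} σ≢τ with onLine? σ (through σ (x₀ , y₀)) (x , y) | onLine? τ (through τ (x₀ , y₀)) (x , y)
    ... | no _    | _       = inj₁ ≡.refl
    ... | yes _   | no _    = inj₂ ≡.refl
    ... | yes onσ | yes onτ = inj₁ (≡.trans (≡.cong (uncurry M) (lines-through-meet-only-at σ≢τ onσ onτ)) empty)

  lineCounts-through-empty-point-≤-size : ∀ (M : Multiset) {x₀ y₀} → M x₀ y₀ ≡ 0 →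
    sum (map (λ σ → lineCount M σ (through σ (x₀ , y₀))) slopes) ≤ size M
  lineCounts-through-empty-point-≤-size M {x₀} {y₀} empty = begin
    sum (map (λ σ → lineCount M σ (through σ P)) slopes)
      ≡⟨ ≡.cong sum (map-cong (λ σ → lineCount≡∑∑restrict M σ (through σ P)) slopes) ⟩
    sum (map (λ σ → ∑ λ x → ∑ λ y → r σ x y) slopes)
      ≡⟨ sum-map-comm (λ σ i → ∑ λ y → r σ (elt i) y) slopes (allFin q) ⟩
    (∑ λ x → sum (map (λ σ → ∑ λ y → r σ x y) slopes))
      ≡⟨ ∑-cong (λ x → sum-map-comm (λ σ j → r σ x (elt j)) slopes (allFin q)) ⟩
    (∑ λ x → ∑ λ y → sum (map (λ σ → r σ x y) slopes))
      ≤⟨ ∑-mono-≤ (λ x → ∑-mono-≤ (λ y → multiplicity-on-lines-through-≤ M empty x y)) ⟩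
    size M ∎
    where
    open ≤-Reasoning
    P : Point
    P = x₀ , y₀
    r : Slope → Carrier → Carrier → ℕ
    r σ x y = restrict (onLine? σ (through σ P) (x , y)) (M x y)

  lineCount-nonSpecial : ∀ M {n σ} → size M ≡ n * q → ¬ Special M σ → ∀ b → lineCount M σ b ≡ n
  lineCount-nonSpecial M {n} {σ} |M|≡nq ¬special b with balanced? M σ b
  ... | yes (inj₁ ≡⌊|M|/q⌋) = ≡.trans ≡⌊|M|/q⌋ (≡.trans (≡.cong (λ m → floorDiv m q) |M|≡nq) (floorDiv-multiple n q))
  ... | yes (inj₂ ≡⌈|M|/q⌉) = ≡.trans ≡⌈|M|/q⌉ (≡.trans (≡.cong (λ m → ceilDiv m q) |M|≡nq) (ceilDiv-multiple n q))
  ... | no unbalanced       = contradiction (λ balanced → unbalanced (balanced b)) ¬special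

  n≤lineCount+[special]*n : ∀ M {n} → size M ≡ n * q → ∀ σ b →
                            n ≤ lineCount M σ b + indicator (special? M σ) * n
  n≤lineCount+[special]*n M {n} |M|≡nq σ b = bound (special? M σ)
    where
    bound : (S? : Dec (Special M σ)) → n ≤ lineCount M σ b + indicator S? * n
    bound (yes _)       = ≤-trans (≤-reflexive (≡.sym (*-identityˡ n))) (m≤n+m (1 * n) (lineCount M σ b))
    bound (no ¬special) = ≤-reflexive (≡.sym (≡.trans (+-identityʳ _) (lineCount-nonSpecial M |M|≡nq ¬special b)))

  n+lineCount≤numSpecial*n : ∀ M {n x₀ y₀ s} → size M ≡ n * q → M x₀ y₀ ≡ 0 → Special M s →
                             n + lineCount M s (through s (x₀ , y₀)) ≤ numSpecial M * n
  n+lineCount≤numSpecial*n M {n} {x₀} {y₀} {s} |M|≡nq empty special =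
    +-cancelʳ-≤ (q * n) (n + L s) (numSpecial M * n) (begin
      n + L s + q * n                          ≡⟨ xy∙z≈xz∙y n (q * n) (L s) ⟨
      suc q * n + L s                          ≡⟨ ≡.cong (λ k → k * n + L s) length-slopes ⟨
      length slopes * n + L s                  ≤⟨ length*n+c≤sum-map n≤weight (∈-slopes s) n+Ls≤weight ⟩
      sum (map weight slopes)                  ≡⟨ sum-map-+ L (λ σ → [special] σ * n) slopes ⟩
      sum (map L slopes) + sum (map (λ σ → [special] σ * n) slopes)
                                               ≡⟨ ≡.cong (sum (map L slopes) +_) (sum-map-*ʳ [special] n slopes) ⟩
      sum (map L slopes) + numSpecial M * n    ≤⟨ +-monoˡ-≤ (numSpecial M * n) (lineCounts-through-empty-point-≤-size M empty) ⟩
      size M + numSpecial M * n                ≡⟨ ≡.cong (_+ numSpecial M * n) (≡.trans |M|≡nq (*-comm n q)) ⟩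
      q * n + numSpecial M * n                 ≡⟨ +-comm (q * n) (numSpecial M * n) ⟩
      numSpecial M * n + q * n                 ∎)
    where
    open ≤-Reasoning
    L : Slope → ℕ
    L σ = lineCount M σ (through σ (x₀ , y₀))
    [special] : Slope → ℕ
    [special] σ = indicator (special? M σ)
    weight : Slope → ℕ
    weight σ = L σ + [special] σ * n
    n≤weight : ∀ σ → n ≤ weight σ
    n≤weight σ = n≤lineCount+[special]*n M |M|≡nq σ (through σ (x₀ , y₀))
    n+Ls≤weight : n + L s ≤ weight s
    n+Ls≤weight = ≤-reflexive (begin-equality
      n + L s              ≡⟨ +-comm n (L s) ⟩
      L s + n              ≡⟨ ≡.cong (L s +_) (*-identityˡ n) ⟨
      L s + 1 * n          ≡⟨ ≡.cong (λ i → L s + i * n) (indicator-yes (special? M s) special) ⟨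
      weight s             ∎)

lemma3p7 : (p h q : ℕ) → Prime p → 1 < h → q ≡ p ^ h →
    (F : FiniteField q) → let open AG F in
    (n : ℕ) → 1 ≤ n → (M : Multiset) → size M ≡ n * q →
    numSpecial M * n ≤ p →
    ∀ s → Special M s → ∀ b →
    (∃ λ x → ∃ λ y → OnLine s b (x , y) × M x y ≡ 0) →
    lineCount M s b < p
lemma3p7 p h q _ _ _ F n 1≤n M |M|≡nq k*n≤p s special b (x₀ , y₀ , on , empty) = begin-strict
  lineCount M s b                           ≡⟨ ≡.cong (lineCount M s) (through-unique s on) ⟩
  lineCount M s (through s (x₀ , y₀))       <⟨ m<n+m _ 1≤n ⟩
  n + lineCount M s (through s (x₀ , y₀))   ≤⟨ n+lineCount≤numSpecial*n F M |M|≡nq empty special ⟩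
  numSpecial M * n                          ≤⟨ k*n≤p ⟩
  p                                         ∎
  where
  open AG F
  open LinesThrough F
  open ≤-Reasoning
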